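{- Let $n\geq 1$ and $0\leq k\leq n-1$ be integers. There is a bijection from the set $\mathcal{OP}_{n,\geq k}$ of ordered preference sets of length $n$ with at least $k$ flaws to the set $\mathcal{S}_{n,k}=\{(x_1,\dots,x_{n-k})\in\mathbb{N}^{n-k}\mid x_1+x_2+\cdots+x_{n-k}=n+k\}$ (here $\mathbb{N}$ includes $0$).
   Context: Parking model: $n$ parking spaces numbered $1,\dots,n$ from left to right; a preference set of length $n$ is a sequence $(a_1,\dots,a_n)$ with $a_i\in[n]=\{1,\dots,n\}$. Cars $1,\dots,n$ arrive in order; car $i$ goes to space $a_i$, and if it is occupied, moves to the first unoccupied space to the right; if there is none, the car cannot park. A preference set is a $k$-flaw preference set if exactly $k$ cars cannot park (so "flaws" = number of cars that cannot park). A preference set is ordered if $a_1\leq a_2\leq\cdots\leq a_n$. $\mathcal{OP}_{n,\geq k}$ denotes the set of ordered preference sets of length $n$ with at least $k$ flaws. -}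

module Defs where

open import Data.Nat using (ℕ; zero; suc; _+_; _∸_; _≤_; _≥_)
open import Data.Fin using (Fin; toℕ)
open import Data.Bool using (Bool; true; false)
open import Data.Vec using (Vec; []; _∷_)
open import Data.Maybe using (Maybe; just; nothing)
open import Data.Product using (Σ; _×_; _,_)
open import Data.Unit using (⊤)
open import Relation.Binary.PropositionalEquality using (_≡_)

-- Spaces 1..n are represented by Fin n (space i+1 ↔ index i).
-- A preference set of length n: a vector of n preferences in [n].
PrefSet : ℕ → Set
PrefSet n = Vec (Fin n) n

-- Occupancy of spaces: true = occupied.
-- tryPark occ p: the car prefers space p; it takes the first unoccupied
-- space at position ≥ p. Returns the new occupancy, or nothing if no
-- unoccupied space exists at or to the right of p (car cannot park).
tryPark : ∀ {m} → Vec Bool m → ℕ → Maybe (Vec Bool m)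
tryPark [] p = nothing
tryPark (b ∷ occ) (suc p) with tryPark occ p
... | just occ' = just (b ∷ occ')
... | nothing = nothing
tryPark (true ∷ occ) zero with tryPark occ zero
... | just occ' = just (true ∷ occ')
... | nothing = nothing
tryPark (false ∷ occ) zero = just (true ∷ occ)

flawsFrom : ∀ {m l} → Vec Bool m → Vec (Fin m) l → ℕ
flawsFrom occ [] = 0
flawsFrom occ (a ∷ as) with tryPark occ (toℕ a)
... | just occ' = flawsFrom occ' as
... | nothing = suc (flawsFrom occ as)

emptyLot : ∀ m → Vec Bool m
emptyLot zero = []
emptyLot (suc m) = false ∷ emptyLot m

flaws : ∀ {n} → PrefSet n → ℕ
flaws {n} a = flawsFrom (emptyLot n) a

Ordered : ∀ {m l} → Vec (Fin m) l → Set
Ordered [] = ⊤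
Ordered (a ∷ []) = ⊤
Ordered (a ∷ b ∷ as) = (toℕ a ≤ toℕ b) × Ordered (b ∷ as)

OP≥ : ℕ → ℕ → Set
OP≥ n k = Σ (PrefSet n) (λ a → Ordered a × (flaws a ≥ k))

vsum : ∀ {l} → Vec ℕ l → ℕ
vsum [] = 0
vsum (x ∷ xs) = x + vsum xs

S : ℕ → ℕ → Set
S n k = Σ (Vec ℕ (n ∸ k)) (λ x → vsum x ≡ n + k)

-- Write an ordered preference set as a word of stars (cars) and bars (steps to the next
-- space), the cars preferring space i being the stars between the (i-1)-st and i-th bar.
-- Reading the word, the cars that cannot park are as many as the spaces left empty, and
-- there are at least k of them exactly when some prefix has k more bars than stars.
-- Reflecting (swapping stars and bars in) the shortest such prefix maps the words with
-- n - 1 bars and n stars reaching that level bijectively onto all words with n - 1 - k bars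
-- and n + k stars, and stars and bars identifies those with S n k.
module Submission where

open import Defs
open import Data.Bool using (Bool; true; false; not)
open import Data.Bool.Properties using (not-involutive)
open import Data.Empty using (⊥)
open import Data.Maybe using (just; nothing)
open import Data.Fin using (Fin; toℕ) renaming (zero to fzero; suc to fsuc)
open import Data.List using (List; []; _∷_; replicate)
import Data.List as List
import Data.List.Properties as List
open import Data.Nat using (ℕ; zero; suc; pred; _+_; _∸_; _≤_; _<_; z≤n; s≤s; s≤s⁻¹)
open import Data.Nat.Properties
open import Data.Product using (Σ; _×_; _,_)
open import Data.Unit using (⊤; tt)
open import Data.Vec using (Vec; []; _∷_; map)
import Data.Vec as Vec
import Data.Vec.Properties as Vecₚ
open import Function.Base using (id)
open import Function.Bundles using (_⤖_; _↔_; mk↔ₛ′)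
open import Function.Properties.Inverse using (↔⇒⤖; ↔-trans; ↔-sym)
open import Relation.Binary.PropositionalEquality
open import Relation.Nullary using (Irrelevant)

×-irrelevant : {A B : Set} → Irrelevant A → Irrelevant B → Irrelevant (A × B)
×-irrelevant A-irr B-irr (a , b) (a′ , b′) = cong₂ _,_ (A-irr a a′) (B-irr b b′)

restrict-↔ : {A B : Set} {P : A → Set} {Q : B → Set} →
             (∀ {x} → Irrelevant (P x)) → (∀ {y} → Irrelevant (Q y)) →
             (f : A → B) (g : B → A) →
             (∀ {x} → P x → Q (f x)) → (∀ {y} → Q y → P (g y)) →
             (∀ {x} → P x → g (f x) ≡ x) → (∀ {y} → Q y → f (g y) ≡ y) →
             Σ A P ↔ Σ B Q
restrict-↔ {A} {B} {P} {Q} P-irr Q-irr f g f-pres g-pres g∘f f∘g =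
  mk↔ₛ′ to from to∘from from∘to
  where
  to : Σ A P → Σ B Q
  to (x , p) = f x , f-pres p

  from : Σ B Q → Σ A P
  from (y , q) = g y , g-pres q

  to∘from : ∀ y → to (from y) ≡ y
  to∘from (y , q) with f (g y) | f∘g q | f-pres (g-pres q)
  ... | _ | refl | q′ = cong (y ,_) (Q-irr q′ q)

  from∘to : ∀ x → from (to x) ≡ x
  from∘to (x , p) with g (f x) | g∘f p | g-pres (f-pres p)
  ... | _ | refl | p′ = cong (x ,_) (P-irr p′ p)

-- Words of stars (true) and bars (false)

stars : List Bool → ℕ
stars []          = 0
stars (true ∷ w)  = suc (stars w)
stars (false ∷ w) = stars w

bars : List Bool → ℕ
bars []          = 0
bars (true ∷ w)  = bars w
bars (false ∷ w) = suc (bars w)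

stars-map-not : ∀ w → stars (List.map not w) ≡ bars w
stars-map-not []          = refl
stars-map-not (true ∷ w)  = stars-map-not w
stars-map-not (false ∷ w) = cong suc (stars-map-not w)

bars-map-not : ∀ w → bars (List.map not w) ≡ stars w
bars-map-not []          = refl
bars-map-not (true ∷ w)  = cong suc (bars-map-not w)
bars-map-not (false ∷ w) = bars-map-not w

map-not-involutive : ∀ w → List.map not (List.map not w) ≡ w
map-not-involutive w = begin
  List.map not (List.map not w)  ≡⟨ List.map-∘ w ⟨
  List.map (λ b → not (not b)) w ≡⟨ List.map-cong not-involutive w ⟩
  List.map id w                  ≡⟨ List.map-id w ⟩
  w                              ∎
  where open ≡-Reasoning

HasCounts : ℕ → ℕ → List Bool → Set
HasCounts j s w = bars w ≡ j × stars w ≡ s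

hasCounts-irrelevant : ∀ {j s} w → Irrelevant (HasCounts j s w)
hasCounts-irrelevant _ = ×-irrelevant ≡-irrelevant ≡-irrelevant

Word : ℕ → ℕ → Set
Word j s = Σ (List Bool) (HasCounts j s)

starsAndBars : ∀ {j} → ℕ → Vec ℕ j → List Bool
starsAndBars (suc x) v       = true ∷ starsAndBars x v
starsAndBars zero    []      = []
starsAndBars zero    (y ∷ v) = false ∷ starsAndBars y v

toWord : ∀ {j} → Vec ℕ (suc j) → List Bool
toWord (x ∷ v) = starsAndBars x v

incrementHead : ∀ {j} → Vec ℕ (suc j) → Vec ℕ (suc j)
incrementHead (x ∷ v) = suc x ∷ v

toComposition : (j : ℕ) → List Bool → Vec ℕ (suc j)
toComposition j       []          = Vec.replicate (suc j) 0
toComposition j       (true ∷ w)  = incrementHead (toComposition j w)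
toComposition zero    (false ∷ w) = toComposition zero w
toComposition (suc j) (false ∷ w) = 0 ∷ toComposition j w

bars-starsAndBars : ∀ {j} x (v : Vec ℕ j) → bars (starsAndBars x v) ≡ j
bars-starsAndBars (suc x) v       = bars-starsAndBars x v
bars-starsAndBars zero    []      = refl
bars-starsAndBars zero    (y ∷ v) = cong suc (bars-starsAndBars y v)

stars-starsAndBars : ∀ {j} x (v : Vec ℕ j) → stars (starsAndBars x v) ≡ x + vsum v
stars-starsAndBars (suc x) v       = cong suc (stars-starsAndBars x v)
stars-starsAndBars zero    []      = refl
stars-starsAndBars zero    (y ∷ v) = stars-starsAndBars y v

toComposition-starsAndBars : ∀ {j} x (v : Vec ℕ j) → toComposition j (starsAndBars x v) ≡ x ∷ v
toComposition-starsAndBars (suc x) v       = cong incrementHead (toComposition-starsAndBars x v)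
toComposition-starsAndBars zero    []      = refl
toComposition-starsAndBars zero    (y ∷ v) = cong (0 ∷_) (toComposition-starsAndBars y v)

toWord-toComposition : ∀ j w → bars w ≡ j → toWord (toComposition j w) ≡ w
toWord-toComposition zero    []          _  = refl
toWord-toComposition j       (true ∷ w)  eq with toComposition j w | toWord-toComposition j w eq
... | _ ∷ _ | ih = cong (true ∷_) ih
toWord-toComposition (suc j) (false ∷ w) eq
  with toComposition j w | toWord-toComposition j w (suc-injective eq)
... | _ ∷ _ | ih = cong (false ∷_) ih

vsum-toComposition : ∀ j w → bars w ≡ j → vsum (toComposition j w) ≡ stars w
vsum-toComposition zero    []          _  = refl
vsum-toComposition j       (true ∷ w)  eq with toComposition j w | vsum-toComposition j w eq
... | _ ∷ _ | ih = cong suc ih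
vsum-toComposition (suc j) (false ∷ w) eq = vsum-toComposition j w (suc-injective eq)

Composition : ℕ → ℕ → Set
Composition l s = Σ (Vec ℕ l) (λ x → vsum x ≡ s)

compositions↔words : ∀ j s → Composition (suc j) s ↔ Word j s
compositions↔words j s =
  restrict-↔ ≡-irrelevant (λ {w} → hasCounts-irrelevant w) toWord (toComposition j)
    (λ {v} sum≡s → bars-toWord v , trans (stars-toWord v) sum≡s)
    (λ {w} (bars≡j , stars≡s) → trans (vsum-toComposition j w bars≡j) stars≡s)
    (λ {v} _ → toComposition-toWord v)
    (λ {w} (bars≡j , _) → toWord-toComposition j w bars≡j)
  where
  bars-toWord : (v : Vec ℕ (suc j)) → bars (toWord v) ≡ j
  bars-toWord (x ∷ v) = bars-starsAndBars x v

  stars-toWord : (v : Vec ℕ (suc j)) → stars (toWord v) ≡ vsum v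
  stars-toWord (x ∷ v) = stars-starsAndBars x v

  toComposition-toWord : (v : Vec ℕ (suc j)) → toComposition j (toWord v) ≡ v
  toComposition-toWord (x ∷ v) = toComposition-starsAndBars x v

-- The reflection principle

-- reaches g w: some prefix of w has g more bars than stars.
reaches : ℕ → List Bool → Set
reaches zero    w           = ⊤
reaches (suc g) []          = ⊥
reaches (suc g) (false ∷ w) = reaches g w
reaches (suc g) (true ∷ w)  = reaches (suc (suc g)) w

reaches-irrelevant : ∀ g w → Irrelevant (reaches g w)
reaches-irrelevant zero    w           _ _ = refl
reaches-irrelevant (suc g) (false ∷ w)     = reaches-irrelevant g w
reaches-irrelevant (suc g) (true ∷ w)      = reaches-irrelevant (suc (suc g)) w

surplus⇒reaches : ∀ g w → stars w + g ≤ bars w → reaches g w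
surplus⇒reaches zero    w           _ = tt
surplus⇒reaches (suc g) []          ()
surplus⇒reaches (suc g) (false ∷ w) le =
  surplus⇒reaches g w (s≤s⁻¹ (subst (_≤ suc (bars w)) (+-suc (stars w) g) le))
surplus⇒reaches (suc g) (true ∷ w)  le =
  surplus⇒reaches (suc (suc g)) w (subst (_≤ bars w) (sym (+-suc (stars w) (suc g))) le)

-- Swaps stars and bars up to the first prefix with g more bars than stars.
reflect : ℕ → List Bool → List Bool
reflect zero    w           = w
reflect (suc g) []          = []
reflect (suc g) (false ∷ w) = true ∷ reflect g w
reflect (suc g) (true ∷ w)  = false ∷ reflect (suc (suc g)) w

reflect⁻¹ : ℕ → List Bool → List Bool
reflect⁻¹ g v = List.map not (reflect g (List.map not v))

reflect-map-not-reflect : ∀ g w → reflect g (List.map not (reflect g w)) ≡ List.map not w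
reflect-map-not-reflect zero    w           = refl
reflect-map-not-reflect (suc g) []          = refl
reflect-map-not-reflect (suc g) (false ∷ w) = cong (true ∷_) (reflect-map-not-reflect g w)
reflect-map-not-reflect (suc g) (true ∷ w)  = cong (false ∷_) (reflect-map-not-reflect (suc (suc g)) w)

reflect⁻¹-reflect : ∀ g w → reflect⁻¹ g (reflect g w) ≡ w
reflect⁻¹-reflect g w =
  trans (cong (List.map not) (reflect-map-not-reflect g w)) (map-not-involutive w)

reflect-reflect⁻¹ : ∀ g v → reflect g (reflect⁻¹ g v) ≡ v
reflect-reflect⁻¹ g v =
  trans (reflect-map-not-reflect g (List.map not v)) (map-not-involutive v)

bars-reflect : ∀ g w → reaches g w → bars (reflect g w) + g ≡ bars w
bars-reflect zero    w           _ = +-identityʳ (bars w)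
bars-reflect (suc g) (false ∷ w) r = trans (+-suc _ g) (cong suc (bars-reflect g w r))
bars-reflect (suc g) (true ∷ w)  r = trans (sym (+-suc _ (suc g))) (bars-reflect (suc (suc g)) w r)

stars-reflect : ∀ g w → reaches g w → stars (reflect g w) ≡ stars w + g
stars-reflect zero    w           _ = sym (+-identityʳ (stars w))
stars-reflect (suc g) (false ∷ w) r = trans (cong suc (stars-reflect g w r)) (sym (+-suc _ g))
stars-reflect (suc g) (true ∷ w)  r = trans (stars-reflect (suc (suc g)) w r) (+-suc _ (suc g))

reaches-map-not-reflect : ∀ g w → reaches g w → reaches g (List.map not (reflect g w))
reaches-map-not-reflect zero    w           _ = tt
reaches-map-not-reflect (suc g) (false ∷ w) r = reaches-map-not-reflect g w r
reaches-map-not-reflect (suc g) (true ∷ w)  r = reaches-map-not-reflect (suc (suc g)) w r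

ReachingWord : ℕ → ℕ → ℕ → Set
ReachingWord j s g = Σ (List Bool) (λ w → HasCounts j s w × reaches g w)

reflection↔ : ∀ {b s g} → g ≤ b → b ≤ s + g → ReachingWord b s g ↔ Word (b ∸ g) (s + g)
reflection↔ {b} {s} {g} g≤b b≤s+g =
  restrict-↔ (λ {w} → ×-irrelevant (hasCounts-irrelevant w) (reaches-irrelevant g w))
    (λ {v} → hasCounts-irrelevant v) (reflect g) (reflect⁻¹ g) counts-reflect counts-reflect⁻¹
    (λ {w} _ → reflect⁻¹-reflect g w) (λ {v} _ → reflect-reflect⁻¹ g v)
  where
  counts-reflect : ∀ {w} → HasCounts b s w × reaches g w →
                   HasCounts (b ∸ g) (s + g) (reflect g w)
  counts-reflect {w} ((bars≡b , stars≡s) , r) =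
    trans (sym (m+n∸n≡m _ g)) (cong (_∸ g) (trans (bars-reflect g w r) bars≡b)) ,
    trans (stars-reflect g w r) (cong (_+ g) stars≡s)

  counts-reflect⁻¹ : ∀ {v} → HasCounts (b ∸ g) (s + g) v →
                     HasCounts b s (reflect⁻¹ g v) × reaches g (reflect⁻¹ g v)
  counts-reflect⁻¹ {v} (bars≡ , stars≡) = (bars≡b , stars≡s) , reaches-map-not-reflect g u r
    where
    u = List.map not v

    stars-u : stars u ≡ b ∸ g
    stars-u = trans (stars-map-not v) bars≡

    bars-u : bars u ≡ s + g
    bars-u = trans (bars-map-not v) stars≡

    r : reaches g u
    r = surplus⇒reaches g u
          (subst₂ _≤_ (sym (trans (cong (_+ g) stars-u) (m∸n+n≡m g≤b))) (sym bars-u) b≤s+g)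

    bars≡b : bars (List.map not (reflect g u)) ≡ b
    bars≡b = trans (bars-map-not (reflect g u))
               (trans (stars-reflect g u r) (trans (cong (_+ g) stars-u) (m∸n+n≡m g≤b)))

    stars≡s : stars (List.map not (reflect g u)) ≡ s
    stars≡s = +-cancelʳ-≡ g _ s (trans (cong (_+ g) (stars-map-not (reflect g u)))
                                     (trans (bars-reflect g u r) bars-u))

-- Cars that cannot park, read off the word

-- overflow c w: the number of cars that fail to park when c cars are looking for a space at
-- the current one and w continues the word; a bar moves on to the next space, leaving one of
-- the waiting cars parked behind, and at the end of the word one more car takes the last space.
overflow : ℕ → List Bool → ℕ
overflow c []          = pred c
overflow c (true ∷ w)  = overflow (suc c) w
overflow c (false ∷ w) = overflow (pred c) w

overflow-lowerBound : ∀ c w → stars w + c ≤ suc (bars w) + overflow c w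
overflow-lowerBound zero    []          = z≤n
overflow-lowerBound (suc c) []          = ≤-refl
overflow-lowerBound c       (true ∷ w)  =
  subst (_≤ suc (bars w) + overflow (suc c) w) (+-suc (stars w) c) (overflow-lowerBound (suc c) w)
overflow-lowerBound zero    (false ∷ w) = m≤n⇒m≤1+n (overflow-lowerBound zero w)
overflow-lowerBound (suc c) (false ∷ w) =
  subst (_≤ suc (suc (bars w)) + overflow c w) (sym (+-suc (stars w) c)) (s≤s (overflow-lowerBound c w))

-- A prefix with g more bars than stars leaves g spaces that no car reaches.
reaches⇒overflowBound : ∀ g c w → reaches g w → stars w + g ≤ suc (bars w) + overflow c w
reaches⇒overflowBound zero    c w           _ =
  ≤-trans (+-monoʳ-≤ (stars w) z≤n) (overflow-lowerBound c w)
reaches⇒overflowBound (suc g) c (false ∷ w) r =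
  subst (_≤ suc (suc (bars w)) + overflow (pred c) w) (sym (+-suc (stars w) g))
        (s≤s (reaches⇒overflowBound g (pred c) w r))
reaches⇒overflowBound (suc g) c (true ∷ w)  r =
  subst (_≤ suc (bars w) + overflow (suc c) w) (+-suc (stars w) (suc g))
        (reaches⇒overflowBound (suc (suc g)) (suc c) w r)

overflowBound⇒reaches : ∀ g c w → c < g → 1 ≤ overflow c w →
                        stars w + g ≤ suc (bars w) + overflow c w → reaches g w
overflowBound⇒reaches (suc g) zero    []          _   ()  _
overflowBound⇒reaches (suc g) (suc c) []          c<g _   le =
  <-irrefl refl (≤-trans (s≤s⁻¹ c<g) (s≤s⁻¹ le))
overflowBound⇒reaches (suc g) c       (true ∷ w)  c<g pos le =
  overflowBound⇒reaches (suc (suc g)) (suc c) w (s≤s c<g) pos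
    (subst (_≤ suc (bars w) + overflow (suc c) w) (sym (+-suc (stars w) (suc g))) le)
overflowBound⇒reaches (suc zero)    c (false ∷ w) _   _   _  = tt
overflowBound⇒reaches (suc (suc g)) c (false ∷ w) c<g pos le =
  overflowBound⇒reaches (suc g) (pred c) w (pred-< c c<g) pos
    (s≤s⁻¹ (subst (_≤ suc (suc (bars w)) + overflow (pred c) w) (+-suc (stars w) (suc g)) le))
  where
  pred-< : ∀ c → c < suc (suc g) → pred c < suc g
  pred-< zero    _         = s≤s z≤n
  pred-< (suc c) (s≤s c<g) = c<g

reaches⇒≤overflow : ∀ k w → stars w ≡ suc (bars w) → reaches k w → k ≤ overflow 0 w
reaches⇒≤overflow k w stars≡ r =
  +-cancelˡ-≤ (suc (bars w)) k (overflow 0 w)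
    (subst (λ x → x + k ≤ suc (bars w) + overflow 0 w) stars≡ (reaches⇒overflowBound k 0 w r))

≤overflow⇒reaches : ∀ k w → stars w ≡ suc (bars w) → k ≤ overflow 0 w → reaches k w
≤overflow⇒reaches zero    w _      _  = tt
≤overflow⇒reaches (suc k) w stars≡ le =
  overflowBound⇒reaches (suc k) 0 w (s≤s z≤n) (≤-trans (s≤s z≤n) le)
    (subst (λ x → x + suc k ≤ suc (bars w) + overflow 0 w) (sym stars≡)
           (+-monoʳ-≤ (suc (bars w)) le))

Ordered-irrelevant : ∀ {m l} (as : Vec (Fin m) l) → Irrelevant (Ordered as)
Ordered-irrelevant []           _       _         = refl
Ordered-irrelevant (a ∷ [])     _       _         = refl
Ordered-irrelevant (a ∷ b ∷ as) (h , o) (h′ , o′) =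
  cong₂ _,_ (≤-irrelevant h h′) (Ordered-irrelevant (b ∷ as) o o′)

Ordered-tail : ∀ {m l} (a : Fin m) (as : Vec (Fin m) l) → Ordered (a ∷ as) → Ordered as
Ordered-tail a []       _       = tt
Ordered-tail a (b ∷ as) (_ , o) = o

Ordered-cons-zero : ∀ {m l} (as : Vec (Fin (suc m)) l) → Ordered as → Ordered (fzero ∷ as)
Ordered-cons-zero []       _ = tt
Ordered-cons-zero (a ∷ as) o = z≤n , o

Ordered-map : ∀ {m m′ l} (f : Fin m → Fin m′) →
              (∀ {a b} → toℕ a ≤ toℕ b → toℕ (f a) ≤ toℕ (f b)) →
              (as : Vec (Fin m) l) → Ordered as → Ordered (map f as)
Ordered-map f mono []           _       = tt
Ordered-map f mono (a ∷ [])     _       = tt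
Ordered-map f mono (a ∷ b ∷ as) (h , o) = mono h , Ordered-map f mono (b ∷ as) o

shiftDown : ∀ {m} → Fin (suc (suc m)) → Fin (suc m)
shiftDown fzero    = fzero
shiftDown (fsuc a) = a

shiftDown-mono : ∀ {m} {a b : Fin (suc (suc m))} →
                 toℕ a ≤ toℕ b → toℕ (shiftDown a) ≤ toℕ (shiftDown b)
shiftDown-mono {a = fzero}                  _       = z≤n
shiftDown-mono {a = fsuc a} {b = fsuc b} (s≤s h) = h

map-fsuc-shiftDown : ∀ {m l} (a : Fin (suc m)) (as : Vec (Fin (suc (suc m))) l) →
                     Ordered (fsuc a ∷ as) → map fsuc (map shiftDown (fsuc a ∷ as)) ≡ fsuc a ∷ as
map-fsuc-shiftDown a []             _       = refl
map-fsuc-shiftDown a (fsuc b ∷ as) (_ , o) = cong (fsuc a ∷_) (map-fsuc-shiftDown b as o)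

map-shiftDown-fsuc : ∀ {m l} (as : Vec (Fin (suc m)) l) → map shiftDown (map fsuc as) ≡ as
map-shiftDown-fsuc as = trans (sym (Vecₚ.map-∘ shiftDown fsuc as)) (Vecₚ.map-id as)

encode : ∀ {m l} → Vec (Fin (suc m)) l → List Bool
encode {m}     []             = replicate m false
encode         (fzero ∷ as)   = true ∷ encode as
encode {suc m} (fsuc a ∷ as) = false ∷ encode (map shiftDown (fsuc a ∷ as))

decode : (m l : ℕ) → List Bool → Vec (Fin (suc m)) l
decode m       zero    w           = []
decode m       (suc l) []          = fzero ∷ decode m l []
decode m       (suc l) (true ∷ w)  = fzero ∷ decode m l w
decode zero    (suc l) (false ∷ w) = decode zero (suc l) w
decode (suc m) (suc l) (false ∷ w) = map fsuc (decode m (suc l) w)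

bars-encode : ∀ {m l} (as : Vec (Fin (suc m)) l) → bars (encode as) ≡ m
bars-encode {m}     []             = bars-replicate m
  where
  bars-replicate : ∀ m → bars (replicate m false) ≡ m
  bars-replicate zero    = refl
  bars-replicate (suc m) = cong suc (bars-replicate m)
bars-encode         (fzero ∷ as)   = bars-encode as
bars-encode {suc m} (fsuc a ∷ as) = cong suc (bars-encode (map shiftDown (fsuc a ∷ as)))

stars-encode : ∀ {m l} (as : Vec (Fin (suc m)) l) → stars (encode as) ≡ l
stars-encode {m}     []             = stars-replicate m
  where
  stars-replicate : ∀ m → stars (replicate m false) ≡ 0
  stars-replicate zero    = refl
  stars-replicate (suc m) = stars-replicate m
stars-encode         (fzero ∷ as)   = cong suc (stars-encode as)
stars-encode {suc m} (fsuc a ∷ as) = stars-encode (map shiftDown (fsuc a ∷ as))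

Ordered-decode : ∀ m l w → Ordered (decode m l w)
Ordered-decode m       zero    w           = tt
Ordered-decode m       (suc l) []          = Ordered-cons-zero (decode m l []) (Ordered-decode m l [])
Ordered-decode m       (suc l) (true ∷ w)  = Ordered-cons-zero (decode m l w) (Ordered-decode m l w)
Ordered-decode zero    (suc l) (false ∷ w) = Ordered-decode zero (suc l) w
Ordered-decode (suc m) (suc l) (false ∷ w) =
  Ordered-map fsuc s≤s (decode m (suc l) w) (Ordered-decode m (suc l) w)

encode-map-fsuc : ∀ {m l} (as : Vec (Fin (suc m)) l) → encode (map fsuc as) ≡ false ∷ encode as
encode-map-fsuc []       = refl
encode-map-fsuc (a ∷ as) = cong (λ bs → false ∷ encode (a ∷ bs)) (map-shiftDown-fsuc as)

encode-decode : ∀ m l w → HasCounts m l w → encode (decode m l w) ≡ w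
encode-decode zero    zero    []          _               = refl
encode-decode zero    zero    (true ∷ w)  (_ , ())
encode-decode zero    zero    (false ∷ w) (() , _)
encode-decode (suc m) zero    (false ∷ w) (bars≡ , stars≡) =
  cong (false ∷_) (encode-decode m zero w (suc-injective bars≡ , stars≡))
encode-decode m       (suc l) (true ∷ w)  (bars≡ , stars≡) =
  cong (true ∷_) (encode-decode m l w (bars≡ , suc-injective stars≡))
encode-decode (suc m) (suc l) (false ∷ w) (bars≡ , stars≡) =
  trans (encode-map-fsuc (decode m (suc l) w))
        (cong (false ∷_) (encode-decode m (suc l) w (suc-injective bars≡ , stars≡)))

decode-encode : ∀ m l (as : Vec (Fin (suc m)) l) → Ordered as → decode m l (encode as) ≡ as
decode-encode m       zero    []             _ = refl
decode-encode m       (suc l) (fzero ∷ as)   o =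
  cong (fzero ∷_) (decode-encode m l as (Ordered-tail fzero as o))
decode-encode (suc m) (suc l) (fsuc a ∷ as) o =
  trans (cong (map fsuc) (decode-encode m (suc l) (map shiftDown (fsuc a ∷ as))
                           (Ordered-map shiftDown shiftDown-mono (fsuc a ∷ as) o)))
        (map-fsuc-shiftDown a as o)

flawsFrom-map-fsuc : ∀ {m l} (b : Bool) (occ : Vec Bool m) (as : Vec (Fin m) l) →
                     flawsFrom (b ∷ occ) (map fsuc as) ≡ flawsFrom occ as
flawsFrom-map-fsuc b occ []       = refl
flawsFrom-map-fsuc b occ (a ∷ as) with tryPark occ (toℕ a)
... | just occ′ = flawsFrom-map-fsuc b occ′ as
... | nothing   = cong suc (flawsFrom-map-fsuc b occ as)

flawsFrom-occupied : ∀ {m l} (occ : Vec Bool (suc m)) (as : Vec (Fin (suc (suc m))) l) →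
                     flawsFrom (true ∷ occ) as ≡ flawsFrom occ (map shiftDown as)
flawsFrom-occupied occ []             = refl
flawsFrom-occupied occ (fzero ∷ as)   with tryPark occ 0
... | just occ′ = flawsFrom-occupied occ′ as
... | nothing   = cong suc (flawsFrom-occupied occ as)
flawsFrom-occupied occ (fsuc a ∷ as) with tryPark occ (toℕ a)
... | just occ′ = flawsFrom-occupied occ′ as
... | nothing   = cong suc (flawsFrom-occupied occ as)

flawsFrom-full : ∀ {l} (as : Vec (Fin 1) l) → flawsFrom (true ∷ []) as ≡ l
flawsFrom-full []           = refl
flawsFrom-full (fzero ∷ as) = cong suc (flawsFrom-full as)

overflow-replicate : ∀ m → overflow 0 (replicate m false) ≡ 0
overflow-replicate zero    = refl
overflow-replicate (suc m) = overflow-replicate m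

overflow-encode-oneSpace : ∀ c {l} (as : Vec (Fin 1) l) → overflow (suc c) (encode as) ≡ c + l
overflow-encode-oneSpace c []           = sym (+-identityʳ c)
overflow-encode-oneSpace c (fzero ∷ as) =
  trans (overflow-encode-oneSpace (suc c) as) (sym (+-suc c _))

overflow-encode-shiftDown : ∀ {m l} c (as : Vec (Fin (suc (suc m))) l) →
                            overflow (suc c) (encode as) ≡ overflow c (encode (map shiftDown as))
overflow-encode-shiftDown c []             = refl
overflow-encode-shiftDown c (fzero ∷ as)   = overflow-encode-shiftDown (suc c) as
overflow-encode-shiftDown c (fsuc a ∷ as) = refl

flaws-encode : ∀ m {l} (as : Vec (Fin (suc m)) l) → Ordered as →
               flawsFrom (emptyLot (suc m)) as ≡ overflow 0 (encode as)
flaws-encode m       []             _ = sym (overflow-replicate m)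
flaws-encode zero    (fzero ∷ as)   _ =
  trans (flawsFrom-full as) (sym (overflow-encode-oneSpace 0 as))
flaws-encode (suc m) (fzero ∷ as)   o = begin
  flawsFrom (true ∷ emptyLot (suc m)) as            ≡⟨ flawsFrom-occupied (emptyLot (suc m)) as ⟩
  flawsFrom (emptyLot (suc m)) (map shiftDown as)   ≡⟨ flaws-encode m (map shiftDown as) o′ ⟩
  overflow 0 (encode (map shiftDown as))            ≡⟨ overflow-encode-shiftDown 0 as ⟨
  overflow 1 (encode as)                            ∎
  where
  open ≡-Reasoning
  o′ = Ordered-map shiftDown shiftDown-mono as (Ordered-tail fzero as o)
flaws-encode (suc m) (fsuc a ∷ as) o = begin
  flawsFrom (false ∷ lot) (fsuc a ∷ as)     ≡⟨ cong (flawsFrom (false ∷ lot)) (map-fsuc-shiftDown a as o) ⟨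
  flawsFrom (false ∷ lot) (map fsuc bs)     ≡⟨ flawsFrom-map-fsuc false lot bs ⟩
  flawsFrom lot bs                          ≡⟨ flaws-encode m bs o′ ⟩
  overflow 0 (encode bs)                    ∎
  where
  open ≡-Reasoning
  lot = emptyLot (suc m)
  bs  = map shiftDown (fsuc a ∷ as)
  o′  = Ordered-map shiftDown shiftDown-mono (fsuc a ∷ as) o

OP≥↔reachingWords : ∀ m k → OP≥ (suc m) k ↔ ReachingWord m (suc m) k
OP≥↔reachingWords m k =
  restrict-↔ (λ {a} → ×-irrelevant (Ordered-irrelevant a) ≤-irrelevant)
    (λ {w} → ×-irrelevant (hasCounts-irrelevant w) (reaches-irrelevant k w))
    encode (decode m (suc m)) to from
    (λ {a} (o , _) → decode-encode m (suc m) a o)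
    (λ {w} (counts , _) → encode-decode m (suc m) w counts)
  where
  stars≡suc-bars : ∀ w → HasCounts m (suc m) w → stars w ≡ suc (bars w)
  stars≡suc-bars _ (bars≡ , stars≡) = trans stars≡ (cong suc (sym bars≡))

  to : ∀ {a} → Ordered a × k ≤ flaws a → HasCounts m (suc m) (encode a) × reaches k (encode a)
  to {a} (o , k≤flaws) =
    counts , ≤overflow⇒reaches k (encode a) (stars≡suc-bars (encode a) counts)
               (subst (k ≤_) (flaws-encode m a o) k≤flaws)
    where
    counts = bars-encode a , stars-encode a

  from : ∀ {w} → HasCounts m (suc m) w × reaches k w →
         Ordered (decode m (suc m) w) × k ≤ flaws (decode m (suc m) w)
  from {w} (counts , r) =
    o , subst (k ≤_) (sym flaws-decode) (reaches⇒≤overflow k w (stars≡suc-bars w counts) r)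
    where
    o = Ordered-decode m (suc m) w

    flaws-decode : flaws (decode m (suc m) w) ≡ overflow 0 w
    flaws-decode = trans (flaws-encode m _ o) (cong (overflow 0) (encode-decode m (suc m) w counts))

mainTheorem1 : (n k : ℕ) → 1 ≤ n → k ≤ n ∸ 1 → OP≥ n k ⤖ S n k
mainTheorem1 (suc m) k _ k≤m =
  ↔⇒⤖ (↔-trans (OP≥↔reachingWords m k) (↔-trans (reflection↔ k≤m m≤suc-m+k) (↔-sym compositions)))
  where
  m≤suc-m+k : m ≤ suc m + k
  m≤suc-m+k = ≤-trans (n≤1+n m) (m≤m+n (suc m) k)

  compositions : S (suc m) k ↔ Word (m ∸ k) (suc m + k)
  compositions = subst (λ l → Composition l (suc m + k) ↔ Word (m ∸ k) (suc m + k))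
                       (sym (+-∸-assoc 1 k≤m)) (compositions↔words (m ∸ k) (suc m + k))
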